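{- Let $G$ be a bipartite graph with bipartition $\{B,R\}$, where $m:=|B|\ge1$, $n:=|R|\ge 1$ and $m\le n$, and let $k$ be an integer with $1\le k\le m+n-1$. Then \[\beta(F_k(G))\ge \max\Big\{r,\ \binom{n+m}{k}-r\Big\},\qquad\text{where } r=\sum_{i=1}^{\lceil k/2\rceil}\binom{n}{2i-1}\binom{m}{k-2i+1}.\]
   Context: For a simple finite graph $G$ of order $N$ and an integer $1\le k\le N-1$, the $k$-token graph $F_k(G)$ is the graph whose vertices are all $k$-element subsets of $V(G)$, two such subsets being adjacent iff their symmetric difference is an edge of $G$. $\beta$ denotes the independence number. -}

module Defs where

open import Data.Nat using (ℕ; zero; suc; _+_; _*_; _∸_; _<_; _≤_; ⌈_/2⌉; _⊔_)
open import Data.Nat.Combinatorics using (_C_)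
open import Data.Fin using (Fin; toℕ)
open import Data.Fin.Subset using (Subset; _∈_; _∉_; ∣_∣)
open import Data.Product using (Σ; _×_; ∃; ∃-syntax; _,_)
open import Data.Sum using (_⊎_)
open import Data.List using (List; length)
open import Data.List.Membership.Propositional using () renaming (_∈_ to _∈L_)
open import Data.List.Relation.Unary.All using (All)
open import Data.List.Relation.Unary.Unique.Propositional using (Unique)
open import Relation.Binary.PropositionalEquality using (_≡_)
open import Relation.Nullary using (¬_)

record Graph (N : ℕ) : Set₁ where
  field
    Adj   : Fin N → Fin N → Set
    sym   : ∀ {u v} → Adj u v → Adj v u
    irrefl : ∀ {u} → ¬ Adj u u
open Graph public

InB : ∀ {m n} → Fin (m + n) → Set
InB {m} v = toℕ v < m

InR : ∀ {m n} → Fin (m + n) → Set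
InR {m} v = m ≤ toℕ v

IsBipartiteBR : ∀ m n → Graph (m + n) → Set
IsBipartiteBR m n G =
  ∀ u v → Adj G u v → (InB {m} {n} u × InR {m} {n} v) ⊎ (InR {m} {n} u × InB {m} {n} v)

-- Adjacency in the k-token graph F_k(G): the symmetric difference of X and Y
-- is exactly {u, v} with uv an edge of G (u ∈ X∖Y, v ∈ Y∖X, X and Y agree elsewhere).
TokenAdj : ∀ {N} → Graph N → Subset N → Subset N → Set
TokenAdj {N} G X Y =
  ∃[ u ] ∃[ v ] (Adj G u v × u ∈ X × u ∉ Y × v ∈ Y × v ∉ X ×
     (∀ w → ¬ w ≡ u → ¬ w ≡ v → (w ∈ X → w ∈ Y) × (w ∈ Y → w ∈ X)))

IsTokenIndependent : ∀ {N} → Graph N → ℕ → List (Subset N) → Set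
IsTokenIndependent G k I =
  Unique I × All (λ X → ∣ X ∣ ≡ k) I ×
  (∀ X Y → X ∈L I → Y ∈L I → ¬ TokenAdj G X Y)

β-F-≥ : ∀ {N} → Graph N → ℕ → ℕ → Set
β-F-≥ G k b = Σ (List _) λ I → IsTokenIndependent G k I × b ≤ length I

sumFrom1 : ℕ → (ℕ → ℕ) → ℕ
sumFrom1 zero f = 0
sumFrom1 (suc t) f = sumFrom1 t f + f (suc t)

rTerm : ℕ → ℕ → ℕ → ℕ
rTerm m n k = sumFrom1 ⌈ k /2⌉ (λ i → (n C (2 * i ∸ 1)) * (m C ((k + 1) ∸ 2 * i)))

-- Swapping a token along an edge of a bipartite graph moves exactly one token into or out of R,
-- so the parity of |X ∩ R| alternates along every edge of F_k(G). Hence the k-subsets with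
-- |X ∩ R| odd form an independent set, and so do those with |X ∩ R| even. Counting by the size
-- j of X ∩ R, the odd class has Σ_{j odd} C(n,j) C(m,k-j) = r elements, and the even class
-- the remaining C(n+m,k) - r.
module Submission where

open import Defs hiding (sym)
open import Algebra.Properties.CommutativeSemigroup using (interchange)
open import Data.Bool using (true; false; not)
open import Data.Bool.Properties using (¬-not)
open import Data.Fin using (Fin; toℕ; zero; suc)
open import Data.Fin.Properties using (_≟_)
open import Data.Fin.Subset using (Subset; inside; outside; _∈_; _∉_; ∣_∣)
open import Data.List using (List; []; _∷_; [_]; _++_; map; filter; length)
open import Data.List.Properties using (length-map; length-++; filter-++; filter-all; filter-none)
open import Data.List.Membership.Propositional using () renaming (_∈_ to _∈L_)
open import Data.List.Membership.Propositional.Properties using (∈-map⁻)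
open import Data.List.Relation.Unary.All as All using (All; []; _∷_)
open import Data.List.Relation.Unary.All.Properties as All using (all-filter)
open import Data.List.Relation.Unary.AllPairs using ([]; _∷_)
open import Data.List.Relation.Unary.Unique.Propositional using (Unique)
import Data.List.Relation.Unary.Unique.Propositional.Properties as Unique
open import Data.Nat using (ℕ; zero; suc; _+_; _*_; _∸_; _≤_; _<_; _⊔_; ⌈_/2⌉; parity; s≤s)
open import Data.Nat.Solver using (module +-*-Solver)
open import Data.Nat.Combinatorics using (_C_; nCk+nC[k+1]≡[n+1]C[k+1])
open import Data.Nat.Properties
  using (+-assoc; +-comm; +-suc; +-identityʳ; *-identityʳ; *-zeroʳ; +-∸-assoc; n∸n≡0;
         m+n∸m≡n; m≤n⇒m≤1+n; ≤-refl; ≤-reflexive; ⊔-sel; +-commutativeSemigroup)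
open import Data.Parity using (Parity; 0ℙ; 1ℙ; _⁻¹)
open import Data.Parity.Properties using (suc-homo-⁻¹; ⁻¹-selfInverse; p≢p⁻¹)
  renaming (_≟_ to _≟ℙ_)
open import Data.Product using (_×_; _,_; ∃-syntax; map₂; uncurry)
open import Data.Sum using (_⊎_; inj₁; inj₂)
import Data.Sum as Sum
open import Data.Vec using ([]; _∷_; lookup; updateAt)
open import Data.Vec.Properties
  using (∷-injectiveʳ; lookup∘updateAt; lookup∘updateAt′; []=⇒lookup; lookup⇒[]=; tabulate∘lookup; tabulate-cong)
open import Relation.Binary.PropositionalEquality
  using (_≡_; _≢_; refl; sym; trans; cong; cong₂; module ≡-Reasoning)
open import Function using (_∘_)
open import Relation.Nullary using (¬_; Dec; does; yes; no; contradiction)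

module _ {a} {A : Set a} where

  length-filter-parity : (f : A → Parity) (xs : List A) →
    length (filter (λ x → f x ≟ℙ 1ℙ) xs) + length (filter (λ x → f x ≟ℙ 0ℙ) xs) ≡ length xs
  length-filter-parity f [] = refl
  length-filter-parity f (x ∷ xs) with f x
  ... | 1ℙ = cong suc (length-filter-parity f xs)
  ... | 0ℙ = trans (+-suc _ _) (cong suc (length-filter-parity f xs))

  length-filter-map : ∀ {b p} {B : Set b} {P : B → Set p} (P? : ∀ y → Dec (P y)) (f : A → B) (xs : List A) →
    length (filter P? (map f xs)) ≡ length (filter (λ x → P? (f x)) xs)
  length-filter-map P? f [] = refl
  length-filter-map P? f (x ∷ xs) with does (P? (f x))
  ... | true = cong suc (length-filter-map P? f xs)
  ... | false = length-filter-map P? f xs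

combinations : (N k : ℕ) → List (Subset N)
combinations zero zero = [ [] ]
combinations zero (suc k) = []
combinations (suc N) zero = map (outside ∷_) (combinations N zero)
combinations (suc N) (suc k) = map (inside ∷_) (combinations N k) ++ map (outside ∷_) (combinations N (suc k))

length-combinations : ∀ N k → length (combinations N k) ≡ N C k
length-combinations zero zero = refl
length-combinations zero (suc k) = refl
length-combinations (suc N) zero = trans (length-map _ (combinations N zero)) (length-combinations N zero)
length-combinations (suc N) (suc k) = begin
  length (map (inside ∷_) (combinations N k) ++ map (outside ∷_) (combinations N (suc k)))
    ≡⟨ length-++ (map (inside ∷_) (combinations N k)) ⟩
  length (map (inside ∷_) (combinations N k)) + length (map (outside ∷_) (combinations N (suc k)))
    ≡⟨ cong₂ _+_ (length-map _ (combinations N k)) (length-map _ (combinations N (suc k))) ⟩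
  length (combinations N k) + length (combinations N (suc k))
    ≡⟨ cong₂ _+_ (length-combinations N k) (length-combinations N (suc k)) ⟩
  N C k + N C suc k
    ≡⟨ nCk+nC[k+1]≡[n+1]C[k+1] N k ⟩
  suc N C suc k ∎
  where open ≡-Reasoning

combinations-size : ∀ N k → All (λ X → ∣ X ∣ ≡ k) (combinations N k)
combinations-size zero zero = refl ∷ []
combinations-size zero (suc k) = []
combinations-size (suc N) zero = All.map⁺ (combinations-size N zero)
combinations-size (suc N) (suc k) =
  All.++⁺ (All.map⁺ (All.map (cong suc) (combinations-size N k))) (All.map⁺ (combinations-size N (suc k)))

combinations-unique : ∀ N k → Unique (combinations N k)
combinations-unique zero zero = [] ∷ []
combinations-unique zero (suc k) = []
combinations-unique (suc N) zero = Unique.map⁺ ∷-injectiveʳ (combinations-unique N zero)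
combinations-unique (suc N) (suc k) =
  Unique.++⁺ (Unique.map⁺ ∷-injectiveʳ (combinations-unique N k))
             (Unique.map⁺ ∷-injectiveʳ (combinations-unique N (suc k)))
             inside≢outside
  where
  inside≢outside : ∀ {X} → ¬ (X ∈L map (inside ∷_) (combinations N k) × X ∈L map (outside ∷_) (combinations N (suc k)))
  inside≢outside (p , q) with ∈-map⁻ (inside ∷_) p | ∈-map⁻ (outside ∷_) q
  ... | _ , _ , refl | _ , _ , ()

module _ {N : ℕ} where

  ≗-lookup⇒≡ : {X Y : Subset N} → (∀ w → lookup X w ≡ lookup Y w) → X ≡ Y
  ≗-lookup⇒≡ {X} {Y} X≗Y = trans (sym (tabulate∘lookup X)) (trans (tabulate-cong X≗Y) (tabulate∘lookup Y))

  ∉⇒lookup≡outside : {X : Subset N} {w : Fin N} → w ∉ X → lookup X w ≡ outside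
  ∉⇒lookup≡outside {X} {w} w∉X = ¬-not (λ w∈X → w∉X (lookup⇒[]= w X w∈X))

  ∈-agree⇒lookup≡ : {X Y : Subset N} {w : Fin N} → (w ∈ X → w ∈ Y) → (w ∈ Y → w ∈ X) → lookup X w ≡ lookup Y w
  ∈-agree⇒lookup≡ {X} {Y} {w} X⊆Y Y⊆X with lookup X w in w∈X
  ... | true = sym ([]=⇒lookup (X⊆Y (lookup⇒[]= w X w∈X)))
  ... | false = sym (∉⇒lookup≡outside (λ w∈Y → contradiction (trans (sym w∈X) ([]=⇒lookup (Y⊆X w∈Y))) λ ()))

  tokenAdj⇒toggle : ∀ {G : Graph N} {X Y : Subset N} → TokenAdj G X Y →
    ∃[ u ] ∃[ v ] (Adj G u v × Y ≡ updateAt (updateAt X u not) v not)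
  tokenAdj⇒toggle {X = X} {Y} (u , v , uv , u∈X , u∉Y , v∈Y , v∉X , rest) = u , v , uv , ≗-lookup⇒≡ agree
    where
    open ≡-Reasoning
    u≢v : u ≢ v
    u≢v refl = v∉X u∈X
    agree : ∀ w → lookup Y w ≡ lookup (updateAt (updateAt X u not) v not) w
    agree w with w ≟ u | w ≟ v
    ... | yes refl | _ = sym (begin
      lookup (updateAt (updateAt X u not) v not) u ≡⟨ lookup∘updateAt′ u v u≢v (updateAt X u not) ⟩
      lookup (updateAt X u not) u                  ≡⟨ lookup∘updateAt u X ⟩
      not (lookup X u)                             ≡⟨ cong not ([]=⇒lookup u∈X) ⟩
      outside                                      ≡⟨ sym (∉⇒lookup≡outside u∉Y) ⟩
      lookup Y u                                   ∎)
    ... | no w≢u | yes refl = sym (begin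
      lookup (updateAt (updateAt X u not) v not) v ≡⟨ lookup∘updateAt v (updateAt X u not) ⟩
      not (lookup (updateAt X u not) v)            ≡⟨ cong not (lookup∘updateAt′ v u w≢u X) ⟩
      not (lookup X v)                             ≡⟨ cong not (∉⇒lookup≡outside v∉X) ⟩
      inside                                       ≡⟨ sym ([]=⇒lookup v∈Y) ⟩
      lookup Y v                                   ∎)
    ... | no w≢u | no w≢v = begin
      lookup Y w                                   ≡⟨ sym (uncurry ∈-agree⇒lookup≡ (rest w w≢u w≢v)) ⟩
      lookup X w                                   ≡⟨ sym (lookup∘updateAt′ w u w≢u X) ⟩
      lookup (updateAt X u not) w                  ≡⟨ sym (lookup∘updateAt′ w v w≢v (updateAt X u not)) ⟩
      lookup (updateAt (updateAt X u not) v not) w ∎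

parity-suc : ∀ n → parity (suc n) ≡ parity n ⁻¹
parity-suc n = sym (⁻¹-selfInverse (suc-homo-⁻¹ n))

parity-∣toggle∣ : ∀ {N} (i : Fin N) (X : Subset N) → parity ∣ updateAt X i not ∣ ≡ parity ∣ X ∣ ⁻¹
parity-∣toggle∣ zero (true ∷ X) = sym (suc-homo-⁻¹ ∣ X ∣)
parity-∣toggle∣ zero (false ∷ X) = parity-suc ∣ X ∣
parity-∣toggle∣ (suc i) (true ∷ X) =
  trans (parity-suc ∣ updateAt X i not ∣) (cong _⁻¹ (trans (parity-∣toggle∣ i X) (sym (parity-suc ∣ X ∣))))
parity-∣toggle∣ (suc i) (false ∷ X) = parity-∣toggle∣ i X

-- tailSize m X = |X ∩ R|, with R the vertices from position m on.
tailSize : ∀ {N} → ℕ → Subset N → ℕ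
tailSize zero X = ∣ X ∣
tailSize (suc m) [] = 0
tailSize (suc m) (_ ∷ X) = tailSize m X

tailParity : ∀ {N} → ℕ → Subset N → Parity
tailParity m X = parity (tailSize m X)

tailSize-toggle-head : ∀ {N} m (i : Fin N) (X : Subset N) → toℕ i < m →
  tailSize m (updateAt X i not) ≡ tailSize m X
tailSize-toggle-head (suc m) zero (_ ∷ X) _ = refl
tailSize-toggle-head (suc m) (suc i) (_ ∷ X) (s≤s i<m) = tailSize-toggle-head m i X i<m

tailParity-toggle-tail : ∀ {N} m (i : Fin N) (X : Subset N) → m ≤ toℕ i →
  tailParity m (updateAt X i not) ≡ tailParity m X ⁻¹
tailParity-toggle-tail zero i X _ = parity-∣toggle∣ i X
tailParity-toggle-tail (suc m) (suc i) (_ ∷ X) (s≤s m≤i) = tailParity-toggle-tail m i X m≤i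

tokenAdj-tailParity : ∀ m n (G : Graph (m + n)) → IsBipartiteBR m n G →
  ∀ {X Y} → TokenAdj G X Y → tailParity m Y ≡ tailParity m X ⁻¹
tokenAdj-tailParity m n G bipartite {X} adj with tokenAdj⇒toggle {G = G} adj
... | u , v , uv , refl with bipartite u v uv
...   | inj₁ (u∈B , v∈R) =
  trans (tailParity-toggle-tail m v _ v∈R) (cong (λ t → parity t ⁻¹) (tailSize-toggle-head m u X u∈B))
...   | inj₂ (u∈R , v∈B) =
  trans (cong parity (tailSize-toggle-head m v _ v∈B)) (tailParity-toggle-tail m u X u∈R)

parityClass : ℕ → Parity → (N k : ℕ) → List (Subset N)
parityClass m p N k = filter (λ X → tailParity m X ≟ℙ p) (combinations N k)

parityClass-independent : ∀ m n (G : Graph (m + n)) → IsBipartiteBR m n G →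
  ∀ p k → IsTokenIndependent G k (parityClass m p (m + n) k)
parityClass-independent m n G bipartite p k =
  Unique.filter⁺ (λ X → tailParity m X ≟ℙ p) (combinations-unique (m + n) k) ,
  All.filter⁺ (λ X → tailParity m X ≟ℙ p) (combinations-size (m + n) k) ,
  λ X Y X∈ Y∈ adj → p≢p⁻¹ p (begin
    p                 ≡⟨ sym (inClass Y∈) ⟩
    tailParity m Y    ≡⟨ tokenAdj-tailParity m n G bipartite adj ⟩
    tailParity m X ⁻¹ ≡⟨ cong _⁻¹ (inClass X∈) ⟩
    p ⁻¹              ∎)
  where
  open ≡-Reasoning
  inClass : ∀ {X} → X ∈L parityClass m p (m + n) k → tailParity m X ≡ p
  inClass = All.lookup (all-filter (λ X → tailParity m X ≟ℙ p) (combinations (m + n) k))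

length-parityClass-suc-zero : ∀ m p N → length (parityClass (suc m) p (suc N) 0) ≡ length (parityClass m p N 0)
length-parityClass-suc-zero m p N = length-filter-map (λ X → tailParity (suc m) X ≟ℙ p) (outside ∷_) (combinations N 0)

length-parityClass-suc-suc : ∀ m p N k →
  length (parityClass (suc m) p (suc N) (suc k)) ≡ length (parityClass m p N k) + length (parityClass m p N (suc k))
length-parityClass-suc-suc m p N k = begin
  length (filter P? (map (inside ∷_) Xs ++ map (outside ∷_) Ys))
    ≡⟨ cong length (filter-++ P? (map (inside ∷_) Xs) (map (outside ∷_) Ys)) ⟩
  length (filter P? (map (inside ∷_) Xs) ++ filter P? (map (outside ∷_) Ys))
    ≡⟨ length-++ (filter P? (map (inside ∷_) Xs)) ⟩
  length (filter P? (map (inside ∷_) Xs)) + length (filter P? (map (outside ∷_) Ys))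
    ≡⟨ cong₂ _+_ (length-filter-map P? (inside ∷_) Xs) (length-filter-map P? (outside ∷_) Ys) ⟩
  length (parityClass m p N k) + length (parityClass m p N (suc k)) ∎
  where
  open ≡-Reasoning
  P? = λ (X : Subset (suc N)) → tailParity (suc m) X ≟ℙ p
  Xs = combinations N k
  Ys = combinations N (suc k)

toBit : Parity → ℕ
toBit 0ℙ = 0
toBit 1ℙ = 1

length-oddClass-zero : ∀ n k → length (parityClass 0 1ℙ n k) ≡ toBit (parity k) * (n C k)
length-oddClass-zero n k with parity k in k-parity
... | 1ℙ = begin
  length (filter P? (combinations n k))
    ≡⟨ cong length (filter-all P? (All.map (λ {X} → oddSize {X}) (combinations-size n k))) ⟩
  length (combinations n k)
    ≡⟨ length-combinations n k ⟩
  n C k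
    ≡⟨ sym (+-identityʳ (n C k)) ⟩
  1 * (n C k) ∎
  where
  open ≡-Reasoning
  P? = λ (X : Subset n) → tailParity 0 X ≟ℙ 1ℙ
  oddSize : ∀ {X : Subset n} → ∣ X ∣ ≡ k → tailParity 0 X ≡ 1ℙ
  oddSize size = trans (cong parity size) k-parity
... | 0ℙ =
  cong length (filter-none (λ X → tailParity 0 X ≟ℙ 1ℙ) (All.map (λ {X} → evenSize {X}) (combinations-size n k)))
  where
  evenSize : ∀ {X : Subset n} → ∣ X ∣ ≡ k → tailParity 0 X ≢ 1ℙ
  evenSize size X-odd = contradiction (trans (sym k-parity) (trans (cong parity (sym size)) X-odd)) λ ()

sumFrom1-cong : ∀ t {f g : ℕ → ℕ} → (∀ i → i < t → f (suc i) ≡ g (suc i)) → sumFrom1 t f ≡ sumFrom1 t g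
sumFrom1-cong zero f≗g = refl
sumFrom1-cong (suc t) f≗g = cong₂ _+_ (sumFrom1-cong t λ i i<t → f≗g i (m≤n⇒m≤1+n i<t)) (f≗g t ≤-refl)

sumFrom1-zero : ∀ t {f : ℕ → ℕ} → (∀ i → i < t → f (suc i) ≡ 0) → sumFrom1 t f ≡ 0
sumFrom1-zero zero f≗0 = refl
sumFrom1-zero (suc t) f≗0 = cong₂ _+_ (sumFrom1-zero t λ i i<t → f≗0 i (m≤n⇒m≤1+n i<t)) (f≗0 t ≤-refl)

sumFrom1-+ : ∀ t (f g : ℕ → ℕ) → sumFrom1 t (λ i → f i + g i) ≡ sumFrom1 t f + sumFrom1 t g
sumFrom1-+ zero f g = refl
sumFrom1-+ (suc t) f g = trans (cong (_+ (f (suc t) + g (suc t))) (sumFrom1-+ t f g))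
  (interchange +-commutativeSemigroup (sumFrom1 t f) (sumFrom1 t g) (f (suc t)) (g (suc t)))

⌈k/2⌉-nextOdd : ∀ k → (parity k ≡ 0ℙ × 2 * suc ⌈ k /2⌉ ∸ 1 ≡ 1 + k) ⊎ (parity k ≡ 1ℙ × 2 * suc ⌈ k /2⌉ ∸ 1 ≡ 2 + k)
⌈k/2⌉-nextOdd zero = inj₁ (refl , refl)
⌈k/2⌉-nextOdd (suc zero) = inj₂ (refl , refl)
⌈k/2⌉-nextOdd (suc (suc k)) = Sum.map (map₂ add2) (map₂ add2) (⌈k/2⌉-nextOdd k)
  where
  add2 : ∀ {j} → 2 * suc ⌈ k /2⌉ ∸ 1 ≡ j → 2 * suc (suc ⌈ k /2⌉) ∸ 1 ≡ 2 + j
  add2 = trans (cong suc (+-suc ⌈ k /2⌉ (suc (⌈ k /2⌉ + 0)))) ∘ cong (2 +_)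

sumFrom1-odd : ∀ k (h : ℕ → ℕ) → sumFrom1 k (λ j → toBit (parity j) * h j) ≡ sumFrom1 ⌈ k /2⌉ (λ i → h (2 * i ∸ 1))
sumFrom1-odd zero h = refl
sumFrom1-odd (suc zero) h = cong (0 +_) (+-identityʳ (h 1))
sumFrom1-odd (suc (suc k)) h with ⌈k/2⌉-nextOdd k | sumFrom1-odd k h
... | inj₁ (k-even , next) | ih rewrite parity-suc k | k-even =
  trans (+-identityʳ _) (cong₂ _+_ ih (trans (+-identityʳ (h (suc k))) (cong h (sym next))))
... | inj₂ (k-odd , next) | ih rewrite parity-suc k | k-odd =
  cong₂ _+_ (trans (+-identityʳ _) ih) (trans (+-identityʳ (h (2 + k))) (cong h (sym next)))

-- Σ_{j ≤ k, j odd} C(n,j) C(m,k-j); stopping at k keeps the truncated k ∸ j exact.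
oddVandermonde : ℕ → ℕ → ℕ → ℕ
oddVandermonde m n k = sumFrom1 k (λ j → toBit (parity j) * ((n C j) * (m C (k ∸ j))))

oddVandermonde-zero : ∀ n k → oddVandermonde 0 n k ≡ toBit (parity k) * (n C k)
oddVandermonde-zero n zero = refl
oddVandermonde-zero n (suc k) = cong₂ _+_ below last
  where
  below : sumFrom1 k (λ j → toBit (parity j) * ((n C j) * (0 C (suc k ∸ j)))) ≡ 0
  below = sumFrom1-zero k λ i i<k → begin
    toBit (parity (suc i)) * ((n C suc i) * (0 C (k ∸ i)))
      ≡⟨ cong (λ t → toBit (parity (suc i)) * ((n C suc i) * (0 C t))) (+-∸-assoc 1 i<k) ⟩
    toBit (parity (suc i)) * ((n C suc i) * 0)
      ≡⟨ cong (toBit (parity (suc i)) *_) (*-zeroʳ (n C suc i)) ⟩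
    toBit (parity (suc i)) * 0
      ≡⟨ *-zeroʳ (toBit (parity (suc i))) ⟩
    0 ∎
    where open ≡-Reasoning
  last : toBit (parity (suc k)) * ((n C suc k) * (0 C (k ∸ k))) ≡ toBit (parity (suc k)) * (n C suc k)
  last = trans (cong (λ t → toBit (parity (suc k)) * ((n C suc k) * (0 C t))) (n∸n≡0 k))
               (cong (toBit (parity (suc k)) *_) (*-identityʳ (n C suc k)))

pascal-∸ : ∀ m {j k} → j ≤ k → suc m C (suc k ∸ j) ≡ m C (k ∸ j) + m C (suc k ∸ j)
pascal-∸ m {j} {k} j≤k = begin
  suc m C (suc k ∸ j)               ≡⟨ cong (suc m C_) (+-∸-assoc 1 j≤k) ⟩
  suc m C suc (k ∸ j)               ≡⟨ sym (nCk+nC[k+1]≡[n+1]C[k+1] m (k ∸ j)) ⟩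
  m C (k ∸ j) + m C suc (k ∸ j)     ≡⟨ cong (λ t → m C (k ∸ j) + m C t) (sym (+-∸-assoc 1 j≤k)) ⟩
  m C (k ∸ j) + m C (suc k ∸ j)     ∎
  where open ≡-Reasoning

oddVandermonde-pascal : ∀ m n k → oddVandermonde (suc m) n (suc k) ≡ oddVandermonde m n k + oddVandermonde m n (suc k)
oddVandermonde-pascal m n k = begin
  sumFrom1 k F + F (suc k)                     ≡⟨ cong (_+ F (suc k)) (sumFrom1-cong k split) ⟩
  sumFrom1 k (λ j → A j + B j) + F (suc k)     ≡⟨ cong (_+ F (suc k)) (sumFrom1-+ k A B) ⟩
  (sumFrom1 k A + sumFrom1 k B) + F (suc k)    ≡⟨ +-assoc (sumFrom1 k A) (sumFrom1 k B) (F (suc k)) ⟩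
  sumFrom1 k A + (sumFrom1 k B + F (suc k))    ≡⟨ cong (λ t → sumFrom1 k A + (sumFrom1 k B + t)) last ⟩
  sumFrom1 k A + (sumFrom1 k B + B (suc k))    ∎
  where
  open ≡-Reasoning
  open +-*-Solver
  term : ℕ → ℕ → ℕ → ℕ
  term m′ k′ j = toBit (parity j) * ((n C j) * (m′ C (k′ ∸ j)))
  F = term (suc m) (suc k)
  A = term m k
  B = term m (suc k)
  split : ∀ i → i < k → F (suc i) ≡ A (suc i) + B (suc i)
  split i i<k = trans (cong (λ t → toBit (parity (suc i)) * ((n C suc i) * t)) (pascal-∸ m i<k))
    (solve 4 (λ b c x y → b :* (c :* (x :+ y)) := b :* (c :* x) :+ b :* (c :* y)) refl
      (toBit (parity (suc i))) (n C suc i) (m C (k ∸ suc i)) (m C (suc k ∸ suc i)))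
  last : F (suc k) ≡ B (suc k)
  last = trans (cong (λ t → toBit (parity (suc k)) * ((n C suc k) * (suc m C t))) (n∸n≡0 k))
               (cong (λ t → toBit (parity (suc k)) * ((n C suc k) * (m C t))) (sym (n∸n≡0 k)))

length-oddClass≡oddVandermonde : ∀ m n k → length (parityClass m 1ℙ (m + n) k) ≡ oddVandermonde m n k
length-oddClass≡oddVandermonde zero n k = trans (length-oddClass-zero n k) (sym (oddVandermonde-zero n k))
length-oddClass≡oddVandermonde (suc m) n zero =
  trans (length-parityClass-suc-zero m 1ℙ (m + n)) (length-oddClass≡oddVandermonde m n zero)
length-oddClass≡oddVandermonde (suc m) n (suc k) = begin
  length (parityClass (suc m) 1ℙ (suc m + n) (suc k))
    ≡⟨ length-parityClass-suc-suc m 1ℙ (m + n) k ⟩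
  length (parityClass m 1ℙ (m + n) k) + length (parityClass m 1ℙ (m + n) (suc k))
    ≡⟨ cong₂ _+_ (length-oddClass≡oddVandermonde m n k) (length-oddClass≡oddVandermonde m n (suc k)) ⟩
  oddVandermonde m n k + oddVandermonde m n (suc k)
    ≡⟨ sym (oddVandermonde-pascal m n k) ⟩
  oddVandermonde (suc m) n (suc k) ∎
  where open ≡-Reasoning

oddVandermonde≡rTerm : ∀ m n k → oddVandermonde m n k ≡ rTerm m n k
oddVandermonde≡rTerm m n k = trans (sumFrom1-odd k (λ j → (n C j) * (m C (k ∸ j))))
  (sumFrom1-cong ⌈ k /2⌉ λ i _ → cong (λ t → (n C (2 * suc i ∸ 1)) * (m C (t ∸ 2 * suc i))) (+-comm 1 k))

length-oddClass : ∀ m n k → length (parityClass m 1ℙ (m + n) k) ≡ rTerm m n k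
length-oddClass m n k = trans (length-oddClass≡oddVandermonde m n k) (oddVandermonde≡rTerm m n k)

length-evenClass : ∀ m n k → length (parityClass m 0ℙ (m + n) k) ≡ (n + m) C k ∸ rTerm m n k
length-evenClass m n k = begin
  length (parityClass m 0ℙ (m + n) k)
    ≡⟨ sym (m+n∸m≡n (rTerm m n k) _) ⟩
  rTerm m n k + length (parityClass m 0ℙ (m + n) k) ∸ rTerm m n k
    ≡⟨ cong (λ r → r + length (parityClass m 0ℙ (m + n) k) ∸ rTerm m n k) (sym (length-oddClass m n k)) ⟩
  length (parityClass m 1ℙ (m + n) k) + length (parityClass m 0ℙ (m + n) k) ∸ rTerm m n k
    ≡⟨ cong (_∸ rTerm m n k) (length-filter-parity (tailParity m) (combinations (m + n) k)) ⟩
  length (combinations (m + n) k) ∸ rTerm m n k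
    ≡⟨ cong (_∸ rTerm m n k) (trans (length-combinations (m + n) k) (cong (_C k) (+-comm m n))) ⟩
  (n + m) C k ∸ rTerm m n k ∎
  where open ≡-Reasoning

proposition3p4 : (m n : ℕ) → 1 ≤ m → 1 ≤ n → m ≤ n →
    (G : Graph (m + n)) → IsBipartiteBR m n G →
    (k : ℕ) → 1 ≤ k → k ≤ m + n ∸ 1 →
    β-F-≥ G k (rTerm m n k ⊔ (((n + m) C k) ∸ rTerm m n k))
proposition3p4 m n _ _ _ G bipartite k _ _ with ⊔-sel (rTerm m n k) ((n + m) C k ∸ rTerm m n k)
... | inj₁ max≡odd = parityClass m 1ℙ (m + n) k , parityClass-independent m n G bipartite 1ℙ k ,
                      ≤-reflexive (trans max≡odd (sym (length-oddClass m n k)))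
... | inj₂ max≡even = parityClass m 0ℙ (m + n) k , parityClass-independent m n G bipartite 0ℙ k ,
                      ≤-reflexive (trans max≡even (sym (length-evenClass m n k)))
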